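{- If $G$ is a connected block graph of order $n$ whose clique number equals $\omega$, then $cs(G)\leq \max\{ \lceil n/3\rceil,\lceil \omega/2\rceil\}$.
   Context: A block graph is a graph all of whose blocks (maximal 2-connected subgraphs or bridges) are complete graphs. For a graph $G$, a set $S\subseteq V(G)$ is a safe set if $|V(C)|\geq |V(D)|$ for every component $C$ of the induced subgraph $G[S]$ and every component $D$ of $G-S$ (induced by $V(G)\setminus S$) such that some vertex of $C$ is adjacent to some vertex of $D$. The connected safe number $cs(G)$ is the smallest cardinality of a safe set $S$ in $G$ such that $G[S]$ is connected. -}

module Defs where

open import Data.Nat using (ℕ; _+_; _≤_; _⊔_)
open import Data.Nat.DivMod using (_/_)
open import Data.Fin using (Fin)
open import Data.Fin.Subset using (Subset; _∈_; _∉_; _⊆_; ∁; ∣_∣; _-_; ⊤; Nonempty)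
open import Data.Product using (Σ; ∃; _×_; _,_)
open import Relation.Nullary using (¬_)
open import Relation.Binary using (Decidable)
open import Relation.Binary.PropositionalEquality using (_≡_)

record Graph (n : ℕ) : Set₁ where
  field
    Adj    : Fin n → Fin n → Set
    adj?   : Decidable Adj
    sym    : ∀ {u v} → Adj u v → Adj v u
    irrefl : ∀ {u} → ¬ Adj u u

open Graph public

module _ {n : ℕ} (G : Graph n) where

  data WalkIn (X : Subset n) : Fin n → Fin n → Set where
    here : ∀ {u} → u ∈ X → WalkIn X u u
    step : ∀ {u w v} → u ∈ X → Adj G u w → WalkIn X w v → WalkIn X u v

  PairwiseConnectedIn : Subset n → Set
  PairwiseConnectedIn X = ∀ {u v} → u ∈ X → v ∈ X → WalkIn X u v

  -- G[X] is connected (a connected graph is nonempty)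
  ConnectedSet : Subset n → Set
  ConnectedSet X = Nonempty X × PairwiseConnectedIn X

  Connected : Set
  Connected = ConnectedSet ⊤

  IsComponentOf : Subset n → Subset n → Set
  IsComponentOf X C =
    C ⊆ X × ConnectedSet C
      × (∀ {u v} → u ∈ C → v ∈ X → Adj G u v → v ∈ C)

  IsSafe : Subset n → Set
  IsSafe S = ∀ C D → IsComponentOf S C → IsComponentOf (∁ S) D
    → (∃ λ c → ∃ λ d → c ∈ C × d ∈ D × Adj G c d)
    → ∣ D ∣ ≤ ∣ C ∣

  IsConnectedSafe : Subset n → Set
  IsConnectedSafe S = ConnectedSet S × IsSafe S

  NoCutVertex : Subset n → Set
  NoCutVertex B = ∀ {v} → v ∈ B → PairwiseConnectedIn (B - v)

  -- B is the vertex set of a block: a maximal connected subgraph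
  -- without a cut vertex (blocks are induced subgraphs)
  IsBlock : Subset n → Set
  IsBlock B = ConnectedSet B × NoCutVertex B
    × (∀ B' → B ⊆ B' → ConnectedSet B' → NoCutVertex B' → B' ⊆ B)

  IsClique : Subset n → Set
  IsClique K = ∀ {u v} → u ∈ K → v ∈ K → ¬ (u ≡ v) → Adj G u v

  IsBlockGraph : Set
  IsBlockGraph = ∀ B → IsBlock B → IsClique B

  CliqueNumber : ℕ → Set
  CliqueNumber ω = (∃ λ K → IsClique K × ∣ K ∣ ≡ ω)
    × (∀ K → IsClique K → ∣ K ∣ ≤ ω)

  -- cs(G) ≤ k  (cs(G) is the minimum size of a connected safe set)
  ConnectedSafeNumber≤ : ℕ → Set
  ConnectedSafeNumber≤ k = ∃ λ S → IsConnectedSafe S × ∣ S ∣ ≤ k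

-- ⌈ m / d ⌉ for d = 2, 3 (ceiling division)
⌈_/3⌉ : ℕ → ℕ
⌈ m /3⌉ = (m + 2) / 3

⌈_/2⌉′ : ℕ → ℕ
⌈ m /2⌉′ = (m + 1) / 2

-- Start from any connected k-set S.  While some component D of G - S has
-- more than k vertices, exchange a vertex x ∈ S for a vertex w ∈ D so that
-- S stays connected and every component of the new complement is smaller
-- than D.  Once no component exceeds k = ∣S∣, the connected set S is safe.
-- The exchange rests on one fact about block graphs: every cycle spans a
-- clique.  Hence the vertices of S touching D form a clique; either some
-- x ∈ S misses D and is not a cut vertex of G[S], or S is a clique joined
-- completely to the touching part of D, and counting (∣Rest∣ < k) yields an x
-- without neighbours outside S ∪ D.
module Submission where

open import Defs
open import Data.Nat using (ℕ; zero; suc; _+_; _*_; _≤_; _<_; z≤n; s≤s; _≤?_; _⊔_)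
open import Data.Nat.Properties hiding (_≟_)
open import Data.Nat.DivMod using (_/_; _%_; m≡m%n+[m/n]*n; m%n<n; /-monoˡ-≤; m*n/n≡m)
open import Data.Nat.Solver using (module +-*-Solver)
open import Data.Fin using (Fin; zero; suc; _≟_)
open import Data.Fin.Properties using (any?; all?)
open import Data.Fin.Subset
open import Data.Fin.Subset.Properties
open import Data.Vec using ([]; _∷_; here; there)
open import Data.List using (List; []; _∷_)
open import Data.List.Relation.Unary.Any using (here; there)
open import Data.List.Membership.Propositional using () renaming (_∈_ to _∈ˡ_; _∉_ to _∉ˡ_)
open import Data.List.Membership.DecPropositional using () renaming (_∈?_ to ∈ˡ?)
open import Data.Product using (∃; _×_; _,_; proj₁; proj₂)
open import Data.Sum using (_⊎_; inj₁; inj₂; swap)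
open import Relation.Nullary using (¬_; Dec; yes; no; does; contradiction)
open import Relation.Nullary.Decidable using (_×-dec_; _⊎-dec_; ¬?; _→-dec_; decidable-stable)
open import Relation.Binary.PropositionalEquality
  using (_≡_; _≢_; refl; cong; subst; trans; module ≡-Reasoning) renaming (sym to ≡-sym)

setOf : ∀ {n} {P : Fin n → Set} → ((i : Fin n) → Dec (P i)) → Subset n
setOf {zero}  P? = []
setOf {suc n} P? = does (P? zero) ∷ setOf (λ i → P? (suc i))

∈-setOf⁺ : ∀ {n} {P : Fin n → Set} (P? : (i : Fin n) → Dec (P i)) {x} → P x → x ∈ setOf P?
∈-setOf⁺ P? {zero} px with P? zero
... | yes _ = here
... | no ¬p = contradiction px ¬p
∈-setOf⁺ P? {suc x} px = there (∈-setOf⁺ (λ i → P? (suc i)) px)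

∈-setOf⁻ : ∀ {n} {P : Fin n → Set} (P? : (i : Fin n) → Dec (P i)) {x} → x ∈ setOf P? → P x
∈-setOf⁻ P? {zero} x∈ with P? zero
∈-setOf⁻ P? {zero} x∈ | yes p = p
∈-setOf⁻ P? {zero} () | no _
∈-setOf⁻ P? {suc x} (there x∈) = ∈-setOf⁻ (λ i → P? (suc i)) x∈

∣p∪q∣+∣p∩q∣≡∣p∣+∣q∣ : ∀ {n} (p q : Subset n) → ∣ p ∪ q ∣ + ∣ p ∩ q ∣ ≡ ∣ p ∣ + ∣ q ∣
∣p∪q∣+∣p∩q∣≡∣p∣+∣q∣ [] [] = refl
∣p∪q∣+∣p∩q∣≡∣p∣+∣q∣ (inside ∷ p) (inside ∷ q) = cong suc (begin
    ∣ p ∪ q ∣ + suc ∣ p ∩ q ∣ ≡⟨ +-suc ∣ p ∪ q ∣ ∣ p ∩ q ∣ ⟩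
    suc (∣ p ∪ q ∣ + ∣ p ∩ q ∣) ≡⟨ cong suc (∣p∪q∣+∣p∩q∣≡∣p∣+∣q∣ p q) ⟩
    suc (∣ p ∣ + ∣ q ∣) ≡⟨ ≡-sym (+-suc ∣ p ∣ ∣ q ∣) ⟩
    ∣ p ∣ + suc ∣ q ∣ ∎)
  where open ≡-Reasoning
∣p∪q∣+∣p∩q∣≡∣p∣+∣q∣ (inside ∷ p) (outside ∷ q) = cong suc (∣p∪q∣+∣p∩q∣≡∣p∣+∣q∣ p q)
∣p∪q∣+∣p∩q∣≡∣p∣+∣q∣ (outside ∷ p) (inside ∷ q) =
  trans (cong suc (∣p∪q∣+∣p∩q∣≡∣p∣+∣q∣ p q)) (≡-sym (+-suc ∣ p ∣ ∣ q ∣))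
∣p∪q∣+∣p∩q∣≡∣p∣+∣q∣ (outside ∷ p) (outside ∷ q) = ∣p∪q∣+∣p∩q∣≡∣p∣+∣q∣ p q

∣covered∣≤ : ∀ {n} {r : Subset n} (p q : Subset n) → r ⊆ p ∪ q → ∣ r ∣ ≤ ∣ p ∣ + ∣ q ∣
∣covered∣≤ {r = r} p q r⊆ = begin
  ∣ r ∣                     ≤⟨ p⊆q⇒∣p∣≤∣q∣ r⊆ ⟩
  ∣ p ∪ q ∣                 ≤⟨ m≤m+n ∣ p ∪ q ∣ ∣ p ∩ q ∣ ⟩
  ∣ p ∪ q ∣ + ∣ p ∩ q ∣     ≡⟨ ∣p∪q∣+∣p∩q∣≡∣p∣+∣q∣ p q ⟩
  ∣ p ∣ + ∣ q ∣             ∎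
  where open ≤-Reasoning

Disjoint : ∀ {n} → Subset n → Subset n → Set
Disjoint p q = ∀ {i} → i ∈ p → i ∉ q

∣disjoint∣≤ : ∀ {n} {r : Subset n} (p q : Subset n) → Disjoint p q → p ⊆ r → q ⊆ r
            → ∣ p ∣ + ∣ q ∣ ≤ ∣ r ∣
∣disjoint∣≤ {n} {r} p q p∩q=∅ p⊆r q⊆r = begin
  ∣ p ∣ + ∣ q ∣             ≡⟨ ≡-sym (∣p∪q∣+∣p∩q∣≡∣p∣+∣q∣ p q) ⟩
  ∣ p ∪ q ∣ + ∣ p ∩ q ∣     ≡⟨ cong (∣ p ∪ q ∣ +_) ∣p∩q∣≡0 ⟩
  ∣ p ∪ q ∣ + 0             ≡⟨ +-identityʳ ∣ p ∪ q ∣ ⟩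
  ∣ p ∪ q ∣                 ≤⟨ p⊆q⇒∣p∣≤∣q∣ p∪q⊆r ⟩
  ∣ r ∣                     ∎
  where
  open ≤-Reasoning
  ∣p∩q∣≡0 : ∣ p ∩ q ∣ ≡ 0
  ∣p∩q∣≡0 = trans (cong ∣_∣ (Empty-unique λ { (i , i∈) →
              let (i∈p , i∈q) = x∈p∩q⁻ p q i∈ in p∩q=∅ i∈p i∈q }))
              (∣⊥∣≡0 n)
  p∪q⊆r : p ∪ q ⊆ r
  p∪q⊆r i∈ with x∈p∪q⁻ p q i∈
  ... | inj₁ i∈p = p⊆r i∈p
  ... | inj₂ i∈q = q⊆r i∈q

∣p∪⁅x⁆∣≤1+∣p∣ : ∀ {n} (p : Subset n) x → ∣ p ∪ ⁅ x ⁆ ∣ ≤ suc ∣ p ∣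
∣p∪⁅x⁆∣≤1+∣p∣ p x = begin
  ∣ p ∪ ⁅ x ⁆ ∣     ≤⟨ ∣covered∣≤ p ⁅ x ⁆ (λ i∈ → i∈) ⟩
  ∣ p ∣ + ∣ ⁅ x ⁆ ∣ ≡⟨ cong (∣ p ∣ +_) (∣⁅x⁆∣≡1 x) ⟩
  ∣ p ∣ + 1         ≡⟨ +-comm ∣ p ∣ 1 ⟩
  suc ∣ p ∣         ∎
  where open ≤-Reasoning

∣p∪⁅x⁆∣≡1+∣p∣ : ∀ {n} {p : Subset n} {x} → x ∉ p → ∣ p ∪ ⁅ x ⁆ ∣ ≡ suc ∣ p ∣
∣p∪⁅x⁆∣≡1+∣p∣ {p = p} {x} x∉p = ≤-antisym (∣p∪⁅x⁆∣≤1+∣p∣ p x)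
  (p⊂q⇒∣p∣<∣q∣ (p⊆p∪q ⁅ x ⁆ , x , q⊆p∪q p ⁅ x ⁆ (x∈⁅x⁆ x) , x∉p))

1+∣p-x∣≡∣p∣ : ∀ {n} {p : Subset n} {x} → x ∈ p → suc ∣ p - x ∣ ≡ ∣ p ∣
1+∣p-x∣≡∣p∣ {p = p} {x} x∈p = ≤-antisym (x∈p⇒∣p-x∣<∣p∣ x∈p)
  (≤-trans (p⊆q⇒∣p∣≤∣q∣ p⊆p-x∪x) (∣p∪⁅x⁆∣≤1+∣p∣ (p - x) x))
  where
  p⊆p-x∪x : p ⊆ (p - x) ∪ ⁅ x ⁆
  p⊆p-x∪x {i} i∈p with i ≟ x
  ... | yes refl = q⊆p∪q (p - x) ⁅ x ⁆ (x∈⁅x⁆ x)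
  ... | no i≢x   = p⊆p∪q ⁅ x ⁆ (x∈p∧x≢y⇒x∈p-y i∈p i≢x)

x∉p-x : ∀ {n} (p : Subset n) x → x ∉ p - x
x∉p-x (s ∷ p) zero ()
x∉p-x (s ∷ p) (suc x) (there x∈) = x∉p-x p x x∈

x∈p-y⁻ : ∀ {n} {p : Subset n} {x y} → x ∈ p - y → x ∈ p × x ≢ y
x∈p-y⁻ {p = p} {y = y} x∈ = p─q⊆p p ⁅ y ⁆ x∈ , λ { refl → x∉p-x p y x∈ }

∈-insertˡ : ∀ {n} {p : Subset n} {x y} → x ∈ p → x ∈ p ∪ ⁅ y ⁆
∈-insertˡ {y = y} = p⊆p∪q ⁅ y ⁆

∈-insertʳ : ∀ {n} {p : Subset n} {y} → y ∈ p ∪ ⁅ y ⁆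
∈-insertʳ {p = p} {y} = q⊆p∪q p ⁅ y ⁆ (x∈⁅x⁆ y)

∈-insert⁻ : ∀ {n} {p : Subset n} {x y} → x ∈ p ∪ ⁅ y ⁆ → x ∈ p ⊎ x ≡ y
∈-insert⁻ {p = p} {y = y} x∈ with x∈p∪q⁻ p ⁅ y ⁆ x∈
... | inj₁ x∈p = inj₁ x∈p
... | inj₂ x∈y = inj₂ (x∈⁅y⁆⇒x≡y y x∈y)

∣A∣≤∣B∣-by-partners : ∀ {n} (_~_ : Fin n → Fin n → Set) {A B : Subset n}
  → (∀ {a} → a ∈ A → ∃ λ b → b ∈ B × a ~ b)
  → (∀ {a a′ b} → a ∈ A → a′ ∈ A → b ∈ B → a ~ b → a′ ~ b → a ≡ a′)
  → ∣ A ∣ ≤ ∣ B ∣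
∣A∣≤∣B∣-by-partners {n} _~_ {A} = by-fuel ∣ A ∣ ≤-refl
  where
  by-fuel : ∀ f {A B : Subset n} → ∣ A ∣ ≤ f
          → (∀ {a} → a ∈ A → ∃ λ b → b ∈ B × a ~ b)
          → (∀ {a a′ b} → a ∈ A → a′ ∈ A → b ∈ B → a ~ b → a′ ~ b → a ≡ a′)
          → ∣ A ∣ ≤ ∣ B ∣
  by-fuel zero ∣A∣≤0 _ _ = ≤-trans ∣A∣≤0 z≤n
  by-fuel (suc f) {A} {B} ∣A∣≤1+f partner unique with nonempty? A
  ... | no empty = ≤-trans (≤-reflexive (trans (cong ∣_∣ (Empty-unique empty)) (∣⊥∣≡0 n))) z≤n
  ... | yes (a , a∈A) with partner a∈A
  ...   | b , b∈B , a~b = begin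
    ∣ A ∣          ≡⟨ ≡-sym (1+∣p-x∣≡∣p∣ a∈A) ⟩
    suc ∣ A - a ∣  ≤⟨ s≤s (by-fuel f ∣A-a∣≤f partner′ unique′) ⟩
    suc ∣ B - b ∣  ≡⟨ 1+∣p-x∣≡∣p∣ b∈B ⟩
    ∣ B ∣          ∎
    where
    open ≤-Reasoning
    ∣A-a∣≤f : ∣ A - a ∣ ≤ f
    ∣A-a∣≤f = ≤-pred (≤-trans (≤-reflexive (1+∣p-x∣≡∣p∣ a∈A)) ∣A∣≤1+f)
    partner′ : ∀ {a′} → a′ ∈ A - a → ∃ λ b′ → b′ ∈ B - b × a′ ~ b′
    partner′ a′∈ with x∈p-y⁻ a′∈
    ... | a′∈A , a′≢a with partner a′∈A
    ...   | b′ , b′∈B , a′~b′ =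
      b′ , x∈p∧x≢y⇒x∈p-y b′∈B (λ { refl → a′≢a (unique a′∈A a∈A b∈B a′~b′ a~b) }) , a′~b′
    unique′ : ∀ {a₁ a₂ b′} → a₁ ∈ A - a → a₂ ∈ A - a → b′ ∈ B - b → a₁ ~ b′ → a₂ ~ b′ → a₁ ≡ a₂
    unique′ a₁∈ a₂∈ b′∈ = unique (proj₁ (x∈p-y⁻ a₁∈)) (proj₁ (x∈p-y⁻ a₂∈)) (proj₁ (x∈p-y⁻ b′∈))

∣swap∣≡ : ∀ {n} {p : Subset n} {x w} → x ∈ p → w ∉ p → ∣ (p - x) ∪ ⁅ w ⁆ ∣ ≡ ∣ p ∣
∣swap∣≡ {p = p} {x} x∈p w∉p =
  trans (∣p∪⁅x⁆∣≡1+∣p∣ {p = p - x} λ w∈ → w∉p (proj₁ (x∈p-y⁻ w∈))) (1+∣p-x∣≡∣p∣ x∈p)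

∉swap⁻ : ∀ {n} {p : Subset n} {x w v} → v ∉ (p - x) ∪ ⁅ w ⁆ → v ≢ w × (v ∈ p → v ≡ x)
∉swap⁻ {x = x} v∉ = (λ { refl → v∉ ∈-insertʳ }) , λ v∈p → decidable-stable (_ ≟ x)
  λ v≢x → v∉ (∈-insertˡ (x∈p∧x≢y⇒x∈p-y v∈p v≢x))

∈-pair⁻ : ∀ {n} {x y z : Fin n} → z ∈ ⁅ x ⁆ ∪ ⁅ y ⁆ → z ≡ x ⊎ z ≡ y
∈-pair⁻ {x = x} z∈ with ∈-insert⁻ z∈
... | inj₁ z∈x = inj₁ (x∈⁅y⁆⇒x≡y x z∈x)
... | inj₂ z≡y = inj₂ z≡y

module Walks {n : ℕ} (G : Graph n) where

  walk-start : ∀ {X u v} → WalkIn G X u v → u ∈ X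
  walk-start (here u∈) = u∈
  walk-start (step u∈ _ _) = u∈

  walk-end : ∀ {X u v} → WalkIn G X u v → v ∈ X
  walk-end (here v∈) = v∈
  walk-end (step _ _ w) = walk-end w

  walk-mono : ∀ {X Y u v} → X ⊆ Y → WalkIn G X u v → WalkIn G Y u v
  walk-mono X⊆Y (here u∈) = here (X⊆Y u∈)
  walk-mono X⊆Y (step u∈ e w) = step (X⊆Y u∈) e (walk-mono X⊆Y w)

  _++ʷ_ : ∀ {X u v w} → WalkIn G X u v → WalkIn G X v w → WalkIn G X u w
  here _ ++ʷ q = q
  step u∈ e p ++ʷ q = step u∈ e (p ++ʷ q)

  walk-edge : ∀ {X u v} → u ∈ X → v ∈ X → Adj G u v → WalkIn G X u v
  walk-edge u∈ v∈ e = step u∈ e (here v∈)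

  edge-walk : ∀ {u v} → Adj G u v → WalkIn G (⁅ u ⁆ ∪ ⁅ v ⁆) u v
  edge-walk {u} e = walk-edge (∈-insertˡ (x∈⁅x⁆ u)) ∈-insertʳ e

  walk-snoc : ∀ {X u v w} → WalkIn G X u v → Adj G v w → w ∈ X → WalkIn G X u w
  walk-snoc p e w∈ = p ++ʷ walk-edge (walk-end p) w∈ e

  walk-reverse : ∀ {X u v} → WalkIn G X u v → WalkIn G X v u
  walk-reverse (here u∈) = here u∈
  walk-reverse (step u∈ e p) = walk-snoc (walk-reverse p) (sym G e) u∈

  pairwise-via : ∀ {X c} → (∀ {u} → u ∈ X → WalkIn G X u c) → PairwiseConnectedIn G X
  pairwise-via to-c u∈ v∈ = to-c u∈ ++ʷ walk-reverse (to-c v∈)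

  ClosedIn : Subset n → Subset n → Set
  ClosedIn X B = ∀ {u v} → u ∈ B → v ∈ X → Adj G u v → v ∈ B

  walk-confined : ∀ {X B u v} → ClosedIn X B → u ∈ B → WalkIn G X u v → WalkIn G B u v
  walk-confined cl u∈B (here _) = here u∈B
  walk-confined cl u∈B (step _ e p) = step u∈B e (walk-confined cl (cl u∈B (walk-start p) e) p)

  leaving-edge : ∀ {X T u v} → WalkIn G X u v → u ∈ T → v ∉ T
               → ∃ λ a → ∃ λ b → a ∈ T × b ∉ T × a ∈ X × b ∈ X × Adj G a b
  leaving-edge (here _) u∈T v∉T = contradiction u∈T v∉T
  leaving-edge {T = T} (step {w = w} u∈ e p) u∈T v∉T with w ∈? T
  ... | yes w∈T = leaving-edge p w∈T v∉T
  ... | no w∉T = _ , _ , u∈T , w∉T , u∈ , walk-start p , e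

  -- Reachability inside X is computed by saturating under X-neighbours;
  -- the saturation stabilises after at most n rounds.
  module _ (X : Subset n) where

    expand : Subset n → Subset n
    expand R = setOf (λ v → (v ∈? R) ⊎-dec ((v ∈? X) ×-dec any? (λ u → (u ∈? R) ×-dec adj? G u v)))

    R⊆expand : ∀ {R} → R ⊆ expand R
    R⊆expand v∈R = ∈-setOf⁺ _ (inj₁ v∈R)

    expand-closed : ∀ {R} → ClosedIn X R → ClosedIn X (expand R)
    expand-closed cl u∈ v∈X e with ∈-setOf⁻ _ u∈
    ... | inj₁ u∈R = R⊆expand (cl u∈R v∈X e)
    ... | inj₂ (u∈X , w , w∈R , e′) = R⊆expand (cl (cl w∈R u∈X e′) v∈X e)

    expand⊆X : ∀ {R} → R ⊆ X → expand R ⊆ X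
    expand⊆X R⊆X v∈ with ∈-setOf⁻ _ v∈
    ... | inj₁ v∈R = R⊆X v∈R
    ... | inj₂ (v∈X , _) = v∈X

    closed-or-grows : ∀ R → ClosedIn X R ⊎ R ⊂ expand R
    closed-or-grows R with any? (λ v → (v ∈? expand R) ×-dec ¬? (v ∈? R))
    ... | yes (v , v∈ , v∉R) = inj₂ (R⊆expand , v , v∈ , v∉R)
    ... | no ¬new = inj₁ closed
      where
      closed : ClosedIn X R
      closed {u} {v} u∈R v∈X e with v ∈? R
      ... | yes v∈R = v∈R
      ... | no v∉R = contradiction (v , ∈-setOf⁺ _ (inj₂ (v∈X , u , u∈R , e)) , v∉R) ¬new

    iterate : ℕ → Subset n → Subset n
    iterate zero R = R
    iterate (suc f) R = expand (iterate f R)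

    saturation : ∀ f R → ClosedIn X (iterate f R) ⊎ f + ∣ R ∣ ≤ ∣ iterate f R ∣
    saturation zero R = inj₂ ≤-refl
    saturation (suc f) R with saturation f R
    ... | inj₁ cl = inj₁ (expand-closed cl)
    ... | inj₂ big with closed-or-grows (iterate f R)
    ...   | inj₁ cl = inj₁ (expand-closed cl)
    ...   | inj₂ R⊂ = inj₂ (≤-trans (s≤s big) (p⊂q⇒∣p∣<∣q∣ R⊂))

    iterate⊆X : ∀ f {R} → R ⊆ X → iterate f R ⊆ X
    iterate⊆X zero R⊆X = R⊆X
    iterate⊆X (suc f) R⊆X = expand⊆X (iterate⊆X f R⊆X)

    R⊆iterate : ∀ f {R} → R ⊆ iterate f R
    R⊆iterate zero v∈ = v∈
    R⊆iterate (suc f) v∈ = R⊆expand (R⊆iterate f v∈)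

    ReachableFrom : Subset n → Fin n → Set
    ReachableFrom A v = ∃ λ a → a ∈ A × WalkIn G X a v

    iterate-sound : ∀ f {A R} → (∀ {v} → v ∈ R → ReachableFrom A v)
                  → ∀ {v} → v ∈ iterate f R → ReachableFrom A v
    iterate-sound zero sound v∈ = sound v∈
    iterate-sound (suc f) sound v∈ with ∈-setOf⁻ _ v∈
    ... | inj₁ v∈R = iterate-sound f sound v∈R
    ... | inj₂ (v∈X , u , u∈R , e) with iterate-sound f sound u∈R
    ...   | a , a∈A , p = a , a∈A , walk-snoc p e v∈X

    -- The vertices reachable in G[X] from A ∩ X, after n + 1 rounds: a closed
    -- set containing A ∩ X (sizes cannot grow n + 1 times) and nothing else.
    reach : Subset n → Subset n
    reach A = iterate (suc n) (A ∩ X)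

    reach⊆X : ∀ A → reach A ⊆ X
    reach⊆X A = iterate⊆X (suc n) (λ {v} v∈ → proj₂ (x∈p∩q⁻ A X v∈))

    reach-closed : ∀ A → ClosedIn X (reach A)
    reach-closed A with saturation (suc n) (A ∩ X)
    ... | inj₁ cl = cl
    ... | inj₂ big = contradiction (≤-trans (m≤m+n (suc n) _) (≤-trans big (∣p∣≤n (reach A)))) 1+n≰n

    reach-sound : ∀ {A v} → v ∈ reach A → ReachableFrom A v
    reach-sound {A} = iterate-sound (suc n) λ v∈ → let (v∈A , v∈X) = x∈p∩q⁻ A X v∈ in _ , v∈A , here v∈X

    reach-complete : ∀ {A a v} → a ∈ A → WalkIn G X a v → v ∈ reach A
    reach-complete {A} a∈A p =
      walk-end (walk-confined (reach-closed A) (R⊆iterate (suc n) (x∈p∩q⁺ (a∈A , walk-start p))) p)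

  walk? : ∀ X u v → Dec (WalkIn G X u v)
  walk? X u v with v ∈? reach X ⁅ u ⁆
  ... | yes v∈ with reach-sound X v∈
  ...   | a , a∈ , p = yes (subst (λ a → WalkIn G X a v) (x∈⁅y⁆⇒x≡y u a∈) p)
  walk? X u v | no v∉ = no λ p → v∉ (reach-complete X (x∈⁅x⁆ u) p)

module Connectivity {n : ℕ} (G : Graph n) where

  open Walks G

  pairwiseConnected? : ∀ X → Dec (PairwiseConnectedIn G X)
  pairwiseConnected? X
    with all? (λ u → all? (λ v → (u ∈? X) →-dec ((v ∈? X) →-dec walk? X u v)))
  ... | yes all = yes λ {u} {v} → all u v
  ... | no ¬all = no λ pc → ¬all λ u v → pc

  connected? : ∀ X → Dec (ConnectedSet G X)
  connected? X = nonempty? X ×-dec pairwiseConnected? X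

  noCutVertex? : ∀ X → Dec (NoCutVertex G X)
  noCutVertex? X with all? (λ v → (v ∈? X) →-dec pairwiseConnected? (X - v))
  ... | yes all = yes λ {v} → all v
  ... | no ¬all = no λ ncv → ¬all λ v → ncv

  -- Every connected vertex set without a cut vertex lies inside a block:
  -- enlarge it while a strictly larger such set exists (at most n times).
  inside-block : ∀ X → ConnectedSet G X → NoCutVertex G X → ∃ λ B → IsBlock G B × X ⊆ B
  inside-block X = enlarge n X (m≤m+n n ∣ X ∣)
    where
    enlarge : ∀ f X → n ≤ f + ∣ X ∣ → ConnectedSet G X → NoCutVertex G X
            → ∃ λ B → IsBlock G B × X ⊆ B
    enlarge f X n≤ c ncv
      with anySubset? (λ B′ → (X ⊂? B′) ×-dec (connected? B′ ×-dec noCutVertex? B′))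
    ... | no ¬larger = X , (c , ncv , maximal) , λ x∈ → x∈
      where
      maximal : ∀ B′ → X ⊆ B′ → ConnectedSet G B′ → NoCutVertex G B′ → B′ ⊆ X
      maximal B′ X⊆ c′ ncv′ {v} v∈B′ with v ∈? X
      ... | yes v∈X = v∈X
      ... | no v∉X = contradiction (B′ , ((λ {x} → X⊆ {x}) , v , v∈B′ , v∉X) , c′ , (λ {x} → ncv′ {x})) ¬larger
    ... | yes (B′ , X⊂B′ , c′ , ncv′) with f
    ...   | zero = contradiction (≤-trans (≤-trans (s≤s n≤) (p⊂q⇒∣p∣<∣q∣ X⊂B′)) (∣p∣≤n B′)) 1+n≰n
    ...   | suc f′ with enlarge f′ B′ n≤′ c′ ncv′
      where
      n≤′ : n ≤ f′ + ∣ B′ ∣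
      n≤′ = ≤-trans n≤ (≤-trans (≤-reflexive (≡-sym (+-suc f′ ∣ X ∣))) (+-monoʳ-≤ f′ (p⊂q⇒∣p∣<∣q∣ X⊂B′)))
    ...     | B , block , B′⊆B = B , block , λ x∈ → B′⊆B (proj₁ X⊂B′ x∈)

  two-connected⇒clique : IsBlockGraph G → ∀ {X} → ConnectedSet G X → NoCutVertex G X → IsClique G X
  two-connected⇒clique blockGraph {X} c ncv u∈ v∈ u≢v with inside-block X c ncv
  ... | B , block , X⊆B = blockGraph B block (X⊆B u∈) (X⊆B v∈) u≢v

-- In a block graph the vertex set of every cycle is a clique.  Cycles are
-- given by two simple paths joined by two edges.
module Cycles {n : ℕ} (G : Graph n) where

  open Walks G
  open Connectivity G

  _⊆ˡ_ : List (Fin n) → Subset n → Set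
  l ⊆ˡ Y = ∀ {w} → w ∈ˡ l → w ∈ Y

  data SimplePath : Fin n → Fin n → List (Fin n) → Set where
    trivial : ∀ {u} → SimplePath u u (u ∷ [])
    extend  : ∀ {u w v l} → Adj G u w → u ∉ˡ l → SimplePath w v l → SimplePath u v (u ∷ l)

  path-first : ∀ {u v l} → SimplePath u v l → u ∈ˡ l
  path-first trivial = here refl
  path-first (extend _ _ _) = here refl

  path-last : ∀ {u v l} → SimplePath u v l → v ∈ˡ l
  path-last trivial = here refl
  path-last (extend _ _ p) = there (path-last p)

  walk-to-end : ∀ {u v l Y t} → SimplePath u v l → t ∈ˡ l → l ⊆ˡ Y → WalkIn G Y t v
  walk-to-end trivial (here refl) l⊆Y = here (l⊆Y (here refl))
  walk-to-end (extend e _ p) (here refl) l⊆Y =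
    step (l⊆Y (here refl)) e (walk-to-end p (path-first p) (λ w∈ → l⊆Y (there w∈)))
  walk-to-end (extend _ _ p) (there t∈) l⊆Y = walk-to-end p t∈ (λ w∈ → l⊆Y (there w∈))

  walk-around : ∀ {y x l Y z t} → SimplePath y x l → z ∈ˡ l → t ∈ˡ l → t ≢ z
              → (∀ {w} → w ∈ˡ l → w ≢ z → w ∈ Y) → WalkIn G Y t x ⊎ WalkIn G Y t y
  walk-around trivial _ (here refl) t≢z l⊆Y = inj₁ (here (l⊆Y (here refl) t≢z))
  walk-around (extend _ _ _) _ (here refl) t≢z l⊆Y = inj₂ (here (l⊆Y (here refl) t≢z))
  walk-around {y = y} {z = z} (extend e y∉ p) z∈ (there t∈) t≢z l⊆Y with y ≟ z
  ... | yes refl = inj₁ (walk-to-end p t∈ λ w∈ → l⊆Y (there w∈) λ { refl → y∉ w∈ })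
  ... | no y≢z with z∈
  ...   | here z≡y = contradiction (≡-sym z≡y) y≢z
  ...   | there z∈′ with walk-around p z∈′ t∈ t≢z (λ w∈ → l⊆Y (there w∈))
  ...     | inj₁ to-x = inj₁ to-x
  ...     | inj₂ to-w = inj₂ (walk-snoc to-w (sym G e) (l⊆Y (here refl) y≢z))

  path-suffix : ∀ {w v l u} → SimplePath w v l → u ∈ˡ l
              → ∃ λ l′ → SimplePath u v l′ × (∀ {x} → x ∈ˡ l′ → x ∈ˡ l)
  path-suffix trivial (here refl) = _ , trivial , λ x∈ → x∈
  path-suffix p@(extend _ _ _) (here refl) = _ , p , λ x∈ → x∈
  path-suffix (extend _ _ p) (there u∈) with path-suffix p u∈
  ... | l′ , q , l′⊆ = l′ , q , λ x∈ → there (l′⊆ x∈)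

  simple-path : ∀ {X u v} → WalkIn G X u v → ∃ λ l → SimplePath u v l × l ⊆ˡ X
  simple-path (here u∈) = _ , trivial , λ { (here refl) → u∈ }
  simple-path {u = u} (step u∈ e w) with simple-path w
  ... | l , p , l⊆X with ∈ˡ? _≟_ u l
  ...   | yes u∈l = let (l′ , q , l′⊆) = path-suffix p u∈l in l′ , q , λ x∈ → l⊆X (l′⊆ x∈)
  ...   | no u∉l = _ , extend e u∉l p , λ { (here refl) → u∈ ; (there x∈) → l⊆X x∈ }

  vertices : List (Fin n) → List (Fin n) → Subset n
  vertices P R = setOf (λ v → ∈ˡ? _≟_ v P ⊎-dec ∈ˡ? _≟_ v R)

  cycle-minus-vertex : ∀ {y x a b P R Y z} → SimplePath y x P → SimplePath a b R
    → z ∉ˡ R → Adj G x a → Adj G b y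
    → (∀ {w} → w ∈ˡ P → w ≢ z → w ∈ Y) → R ⊆ˡ Y
    → ∀ {t} → t ∈ˡ P ⊎ t ∈ˡ R → t ≢ z → WalkIn G Y t b
  cycle-minus-vertex pP pR z∉R xa by P⊆Y R⊆Y (inj₂ t∈R) t≢z = walk-to-end pR t∈R R⊆Y
  cycle-minus-vertex {x = x} {b = b} {P = P} {Y = Y} {z = z} pP pR z∉R xa by P⊆Y R⊆Y (inj₁ t∈P) t≢z
    with ∈ˡ? _≟_ z P
  ... | no z∉P = walk-to-end pP t∈P (λ w∈ → P⊆Y w∈ λ { refl → z∉P w∈ }) ++ʷ through-R
    where
    through-R : WalkIn G Y x b
    through-R = step (P⊆Y (path-last pP) λ { refl → z∉P (path-last pP) }) xa
                     (walk-to-end pR (path-first pR) R⊆Y)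
  ... | yes z∈P with walk-around pP z∈P t∈P t≢z P⊆Y
  ...   | inj₁ to-x = to-x ++ʷ step (walk-end to-x) xa (walk-to-end pR (path-first pR) R⊆Y)
  ...   | inj₂ to-y = walk-snoc to-y (sym G by) (R⊆Y (path-last pR))

  module _ (blockGraph : IsBlockGraph G) where

    -- In a block graph the vertex set of a cycle, given as two disjoint
    -- simple paths P : y ⇝ x and R : a ⇝ b joined by the edges xa and by,
    -- is a clique: it is connected and has no cut vertex.
    cycle-clique : ∀ {y x a b P R} → SimplePath y x P → SimplePath a b R
                 → (∀ {w} → w ∈ˡ P → w ∉ˡ R) → Adj G x a → Adj G b y
                 → IsClique G (vertices P R)
    cycle-clique {y} {x} {a} {b} {P} {R} pP pR P∩R=∅ xa by =
      two-connected⇒clique blockGraph ((y , P⊆C (path-first pP)) , pairwise-via to-b) no-cut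
      where
      C : Subset n
      C = vertices P R
      P⊆C : P ⊆ˡ C
      P⊆C w∈ = ∈-setOf⁺ _ (inj₁ w∈)
      R⊆C : R ⊆ˡ C
      R⊆C w∈ = ∈-setOf⁺ _ (inj₂ w∈)
      C⁻ : ∀ {t} → t ∈ C → t ∈ˡ P ⊎ t ∈ˡ R
      C⁻ = ∈-setOf⁻ _
      to-b : ∀ {t} → t ∈ C → WalkIn G C t b
      to-b t∈ with C⁻ t∈
      ... | inj₂ t∈R = walk-to-end pR t∈R R⊆C
      ... | inj₁ t∈P = walk-to-end pP t∈P P⊆C
                       ++ʷ step (P⊆C (path-last pP)) xa (walk-to-end pR (path-first pR) R⊆C)
      in-C-minus : ∀ {z w} → w ∈ C → w ≢ z → w ∈ C - z
      in-C-minus = x∈p∧x≢y⇒x∈p-y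
      no-cut : NoCutVertex G C
      no-cut {z} z∈ with C⁻ z∈
      ... | inj₁ z∈P = pairwise-via λ t∈ → let (t∈C , t≢z) = x∈p-y⁻ t∈ in
        cycle-minus-vertex pP pR (P∩R=∅ z∈P) xa by (λ w∈ → in-C-minus (P⊆C w∈))
          (λ w∈ → in-C-minus (R⊆C w∈) λ { refl → P∩R=∅ z∈P w∈ }) (C⁻ t∈C) t≢z
      ... | inj₂ z∈R = pairwise-via λ t∈ → let (t∈C , t≢z) = x∈p-y⁻ t∈ in
        cycle-minus-vertex pR pP (λ z∈P → P∩R=∅ z∈P z∈R) by xa (λ w∈ → in-C-minus (R⊆C w∈))
          (λ w∈ → in-C-minus (P⊆C w∈) λ { refl → P∩R=∅ w∈ z∈R }) (swap (C⁻ t∈C)) t≢z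

    square-clique : ∀ {S D y x a b} → Disjoint S D → WalkIn G S y x → WalkIn G D a b
                  → Adj G x a → Adj G b y
                  → ∃ λ K → IsClique G K × x ∈ K × y ∈ K × a ∈ K × b ∈ K
    square-clique S∩D=∅ wS wD xa by with simple-path wS | simple-path wD
    ... | P , pP , P⊆S | R , pR , R⊆D =
      vertices P R , cycle-clique pP pR (λ w∈P w∈R → S∩D=∅ (P⊆S w∈P) (R⊆D w∈R)) xa by ,
      ∈-setOf⁺ _ (inj₁ (path-last pP)) , ∈-setOf⁺ _ (inj₁ (path-first pP)) ,
      ∈-setOf⁺ _ (inj₂ (path-first pR)) , ∈-setOf⁺ _ (inj₂ (path-last pR))

module Components {n : ℕ} (G : Graph n) where

  open Walks G

  clique-connected : ∀ {K c} → IsClique G K → c ∈ K → PairwiseConnectedIn G K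
  clique-connected {K} {c} clique c∈K = pairwise-via to-c
    where
    to-c : ∀ {u} → u ∈ K → WalkIn G K u c
    to-c {u} u∈K with u ≟ c
    ... | yes refl = here u∈K
    ... | no u≢c = walk-edge u∈K c∈K (clique u∈K c∈K u≢c)

  insert-connected : ∀ {S a b} → PairwiseConnectedIn G S → a ∈ S → Adj G a b
                   → PairwiseConnectedIn G (S ∪ ⁅ b ⁆)
  insert-connected {S} {a} {b} pc a∈S e = pairwise-via to-a
    where
    to-a : ∀ {u} → u ∈ S ∪ ⁅ b ⁆ → WalkIn G (S ∪ ⁅ b ⁆) u a
    to-a u∈ with ∈-insert⁻ u∈
    ... | inj₁ u∈S = walk-mono ∈-insertˡ (pc u∈S a∈S)
    ... | inj₂ refl = walk-edge u∈ (∈-insertˡ a∈S) (sym G e)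

  component : Subset n → Fin n → Subset n
  component X v = reach X ⁅ v ⁆

  component-isComponent : ∀ {X v} → v ∈ X → IsComponentOf G X (component X v)
  component-isComponent {X} {v} v∈X =
    reach⊆X X ⁅ v ⁆ , ((v , v∈C) , pairwise-via to-v) , reach-closed X ⁅ v ⁆
    where
    v∈C : v ∈ component X v
    v∈C = reach-complete X (x∈⁅x⁆ v) (here v∈X)
    to-v : ∀ {u} → u ∈ component X v → WalkIn G (component X v) u v
    to-v u∈ with reach-sound X u∈
    ... | a , a∈ , p rewrite x∈⁅y⁆⇒x≡y v a∈ = walk-reverse (walk-confined (reach-closed X ⁅ v ⁆) v∈C p)

  connected⊆closed : ∀ {X D B d} → D ⊆ X → PairwiseConnectedIn G D → ClosedIn X B
                   → d ∈ D → d ∈ B → D ⊆ B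
  connected⊆closed D⊆X pc closed d∈D d∈B u∈D = walk-end (walk-confined closed d∈B (walk-mono D⊆X (pc d∈D u∈D)))

  component⊆closed : ∀ {X D B d} → IsComponentOf G X D → ClosedIn X B → d ∈ D → d ∈ B → D ⊆ B
  component⊆closed (D⊆X , (_ , pc) , _) = connected⊆closed D⊆X pc

  component-maximal : ∀ {X D d} → IsComponentOf G X D → d ∈ D → D ⊆ component X d
  component-maximal {X} {d = d} (D⊆X , (_ , pc) , _) d∈D =
    connected⊆closed D⊆X pc (reach-closed X ⁅ d ⁆) d∈D (reach-complete X (x∈⁅x⁆ d) (here (D⊆X d∈D)))

  connected⊆component : ∀ {S C} → ConnectedSet G S → IsComponentOf G S C → S ⊆ C
  connected⊆component (_ , pcS) (C⊆S , ((c , c∈C) , _) , closed) =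
    connected⊆closed (λ s∈ → s∈) pcS closed (C⊆S c∈C) c∈C

  components-below : ∀ {X m} → (∀ {v} → v ∈ X → ∃ λ B → v ∈ B × ClosedIn X B × ∣ B ∣ < m)
                   → ∀ D → IsComponentOf G X D → ∣ D ∣ < m
  components-below cover D isComp@(D⊆X , ((d , d∈D) , _) , _) with cover (D⊆X d∈D)
  ... | B , d∈B , closed , ∣B∣<m = ≤-trans (s≤s (p⊆q⇒∣p∣≤∣q∣ (component⊆closed isComp closed d∈D d∈B))) ∣B∣<m

  large-component? : ∀ S k → (∀ D → IsComponentOf G (∁ S) D → ∣ D ∣ ≤ k)
                           ⊎ (∃ λ D → IsComponentOf G (∁ S) D × k < ∣ D ∣)
  large-component? S k with any? (λ v → (v ∈? ∁ S) ×-dec (suc k ≤? ∣ component (∁ S) v ∣))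
  ... | yes (v , v∈ , big) = inj₂ (component (∁ S) v , component-isComponent v∈ , big)
  ... | no ¬big = inj₁ small
    where
    small : ∀ D → IsComponentOf G (∁ S) D → ∣ D ∣ ≤ k
    small D isComp@(D⊆ , ((d , d∈D) , _) , _) with suc k ≤? ∣ component (∁ S) d ∣
    ... | yes big = contradiction (d , D⊆ d∈D , big) ¬big
    ... | no ¬big′ = ≤-trans (p⊆q⇒∣p∣≤∣q∣ (component-maximal isComp d∈D)) (≮⇒≥ ¬big′)

  -- A connected S is safe when no component of G - S is larger than S
  -- (S itself is then the only component of G[S]).
  safe-if-components-small : ∀ {S} → ConnectedSet G S
    → (∀ D → IsComponentOf G (∁ S) D → ∣ D ∣ ≤ ∣ S ∣) → IsSafe G S
  safe-if-components-small cS small C D isCompC isCompD _ =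
    ≤-trans (small D isCompD) (p⊆q⇒∣p∣≤∣q∣ (connected⊆component cS isCompC))

  -- A connected graph has connected vertex sets of every size 1, …, n:
  -- grow one vertex at a time along an edge leaving the current set.
  connected-subset : Connected G → ∀ j → 1 ≤ j → j ≤ n → ∃ λ S → ConnectedSet G S × ∣ S ∣ ≡ j
  connected-subset ((v , _) , _) 1 _ _ = ⁅ v ⁆ , ((v , x∈⁅x⁆ v) , clique-connected single (x∈⁅x⁆ v)) , ∣⁅x⁆∣≡1 v
    where
    single : IsClique G ⁅ v ⁆
    single u∈ w∈ u≢w = contradiction (trans (x∈⁅y⁆⇒x≡y v u∈) (≡-sym (x∈⁅y⁆⇒x≡y v w∈))) u≢w
  connected-subset conn (suc (suc j)) _ j+2≤n
    with connected-subset conn (suc j) (s≤s z≤n) (≤-trans (n≤1+n _) j+2≤n)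
  ... | S , ((s , s∈S) , pcS) , ∣S∣≡ with any? (λ u → ¬? (u ∈? S))
  ...   | no ¬outside = contradiction (≤-trans j+2≤n n≤j+1) 1+n≰n
    where
    n≤j+1 : n ≤ suc j
    n≤j+1 = ≤-trans (≤-reflexive (≡-sym (∣⊤∣≡n n)))
              (≤-trans (p⊆q⇒∣p∣≤∣q∣ {p = ⊤} λ {u} _ → decidable-stable (u ∈? S) λ u∉S → ¬outside (u , u∉S))
                       (≤-reflexive ∣S∣≡))
  ...   | yes (u , u∉S) with leaving-edge (proj₂ conn ∈⊤ ∈⊤) s∈S u∉S
  ...     | a , b , a∈S , b∉S , _ , _ , e =
    S ∪ ⁅ b ⁆ , ((b , ∈-insertʳ) , insert-connected pcS a∈S e) , trans (∣p∪⁅x⁆∣≡1+∣p∣ b∉S) (cong suc ∣S∣≡)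

  -- If T ⊊ S with G[S] and G[T] connected and T nonempty, then some vertex
  -- of S outside T is not a cut vertex of G[S]: grow T along edges inside S
  -- until a single vertex b of S is left out; then S - b = T is connected.
  non-cut-vertex-outside : ∀ {S T t y} → T ⊆ S → PairwiseConnectedIn G S → PairwiseConnectedIn G T
    → t ∈ T → y ∈ S → y ∉ T → ∃ λ x → x ∈ S × x ∉ T × PairwiseConnectedIn G (S - x)
  non-cut-vertex-outside {S} {T} = by-fuel n (≤-trans (∣p∣≤n S) (m≤m+n n ∣ T ∣))
    where
    by-fuel : ∀ f {T t y} → ∣ S ∣ ≤ f + ∣ T ∣ → T ⊆ S → PairwiseConnectedIn G S → PairwiseConnectedIn G T
      → t ∈ T → y ∈ S → y ∉ T → ∃ λ x → x ∈ S × x ∉ T × PairwiseConnectedIn G (S - x)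
    by-fuel f {T} {y = y} ∣S∣≤ T⊆S pcS pcT t∈T y∈S y∉T with leaving-edge (pcS (T⊆S t∈T) y∈S) t∈T y∉T
    ... | a , b , a∈T , b∉T , _ , b∈S , e with any? (λ v → (v ∈? S) ×-dec ¬? (v ∈? T ∪ ⁅ b ⁆))
    ...   | no ¬more = b , b∈S , b∉T , λ u∈ v∈ → walk-mono T⊆S-b (pcT (in-T u∈) (in-T v∈))
      where
      in-T : ∀ {u} → u ∈ S - b → u ∈ T
      in-T u∈ with x∈p-y⁻ u∈
      ... | u∈S , u≢b with ∈-insert⁻ (decidable-stable (_ ∈? T ∪ ⁅ b ⁆) λ u∉ → ¬more (_ , u∈S , u∉))
      ...   | inj₁ u∈T = u∈T
      ...   | inj₂ u≡b = contradiction u≡b u≢b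
      T⊆S-b : T ⊆ S - b
      T⊆S-b u∈T = x∈p∧x≢y⇒x∈p-y (T⊆S u∈T) λ { refl → b∉T u∈T }
    ...   | yes (y′ , y′∈S , y′∉T′) with f
    ...     | zero = contradiction (≤-trans (p⊂q⇒∣p∣<∣q∣ (T⊆S , y , y∈S , y∉T)) ∣S∣≤) 1+n≰n
    ...     | suc f′ with by-fuel f′ ∣S∣≤′ T′⊆S pcS (insert-connected pcT a∈T e) (∈-insertˡ t∈T) y′∈S y′∉T′
      where
      ∣S∣≤′ : ∣ S ∣ ≤ f′ + ∣ T ∪ ⁅ b ⁆ ∣
      ∣S∣≤′ = ≤-trans ∣S∣≤ (≤-reflexive
                (trans (≡-sym (+-suc f′ ∣ T ∣)) (cong (f′ +_) (≡-sym (∣p∪⁅x⁆∣≡1+∣p∣ b∉T)))))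
      T′⊆S : T ∪ ⁅ b ⁆ ⊆ S
      T′⊆S u∈ with ∈-insert⁻ u∈
      ... | inj₁ u∈T = T⊆S u∈T
      ... | inj₂ refl = b∈S
    ...       | x , x∈S , x∉T′ , pc = x , x∈S , (λ x∈T → x∉T′ (∈-insertˡ x∈T)) , pc

rest-bound : ∀ k d r → k + d + r ≤ k + k + k → k < d → r < k
rest-bound k d r total k<d = +-cancelˡ-≤ k (suc r) k (begin
  k + suc r  ≡⟨ +-suc k r ⟩
  suc k + r  ≤⟨ +-monoˡ-≤ r k<d ⟩
  d + r      ≤⟨ +-cancelˡ-≤ k (d + r) (k + k) (begin
                  k + (d + r)  ≡⟨ ≡-sym (+-assoc k d r) ⟩
                  k + d + r    ≤⟨ total ⟩
                  k + k + k    ≡⟨ +-assoc k k k ⟩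
                  k + (k + k)  ∎) ⟩
  k + k      ∎)
  where open ≤-Reasoning

module Exchange {n : ℕ} (G : Graph n) (conn : Connected G) (blockGraph : IsBlockGraph G)
                {ω k : ℕ} (ω-max : ∀ K → IsClique G K → ∣ K ∣ ≤ ω)
                (n≤3k : n ≤ k + k + k) (ω≤2k : ω ≤ k + k) where

  open Walks G
  open Cycles G
  open Components G

  Improvement : ℕ → Set
  Improvement m = ∃ λ S′ → ConnectedSet G S′ × ∣ S′ ∣ ≡ k
                    × (∀ D′ → IsComponentOf G (∁ S′) D′ → ∣ D′ ∣ < m)

  module _ {S D : Subset n} (cS : ConnectedSet G S) (∣S∣≡k : ∣ S ∣ ≡ k)
           (isCompD : IsComponentOf G (∁ S) D) (k<∣D∣ : k < ∣ D ∣) where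

    pcS : PairwiseConnectedIn G S
    pcS = proj₂ cS

    pcD : PairwiseConnectedIn G D
    pcD = proj₂ (proj₁ (proj₂ isCompD))

    D∉S : ∀ {d} → d ∈ D → d ∉ S
    D∉S d∈D = x∈∁p⇒x∉p (proj₁ isCompD d∈D)

    D-closed : ∀ {u v} → u ∈ D → v ∉ S → Adj G u v → v ∈ D
    D-closed u∈D v∉S = proj₂ (proj₂ isCompD) u∈D (x∉p⇒x∈∁p v∉S)

    Rest : Subset n
    Rest = setOf (λ v → ¬? (v ∈? S) ×-dec ¬? (v ∈? D))

    Rest⁺ : ∀ {v} → v ∉ S → v ∉ D → v ∈ Rest
    Rest⁺ v∉S v∉D = ∈-setOf⁺ _ (v∉S , v∉D)

    Rest⁻ : ∀ {v} → v ∈ Rest → v ∉ S × v ∉ D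
    Rest⁻ = ∈-setOf⁻ _

    Rest≁D : ∀ {r d} → r ∈ Rest → d ∈ D → ¬ Adj G r d
    Rest≁D r∈ d∈D e = let (r∉S , r∉D) = Rest⁻ r∈ in r∉D (D-closed d∈D r∉S (sym G e))

    -- S, D and Rest are disjoint, so ∣S∣ + ∣D∣ + ∣Rest∣ ≤ n ≤ 3k; as ∣S∣ = k < ∣D∣,
    -- Rest has fewer than k vertices.
    ∣Rest∣<k : ∣ Rest ∣ < k
    ∣Rest∣<k = rest-bound k ∣ D ∣ ∣ Rest ∣
      (≤-trans (subst (λ s → s + ∣ D ∣ + ∣ Rest ∣ ≤ n) ∣S∣≡k total) n≤3k) k<∣D∣
      where
      S∪D∩Rest=∅ : Disjoint (S ∪ D) Rest
      S∪D∩Rest=∅ v∈ v∈R with x∈p∪q⁻ S D v∈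
      ... | inj₁ v∈S = proj₁ (Rest⁻ v∈R) v∈S
      ... | inj₂ v∈D = proj₂ (Rest⁻ v∈R) v∈D
      total : ∣ S ∣ + ∣ D ∣ + ∣ Rest ∣ ≤ n
      total = begin
        ∣ S ∣ + ∣ D ∣ + ∣ Rest ∣  ≤⟨ +-monoˡ-≤ ∣ Rest ∣
                                      (∣disjoint∣≤ S D (λ s∈ d∈ → D∉S d∈ s∈) (p⊆p∪q D) (q⊆p∪q S D)) ⟩
        ∣ S ∪ D ∣ + ∣ Rest ∣      ≤⟨ ∣disjoint∣≤ (S ∪ D) Rest S∪D∩Rest=∅ ⊆⊤ ⊆⊤ ⟩
        ∣ ⊤ {n} ∣                 ≡⟨ ∣⊤∣≡n n ⟩
        n                         ∎
        where open ≤-Reasoning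

    ∣Rest∣+1<∣D∣ : suc ∣ Rest ∣ < ∣ D ∣
    ∣Rest∣+1<∣D∣ = ≤-trans (s≤s ∣Rest∣<k) k<∣D∣

    TouchS : Subset n
    TouchS = setOf (λ v → (v ∈? S) ×-dec any? (λ d → (d ∈? D) ×-dec adj? G v d))

    TouchD : Subset n
    TouchD = setOf (λ v → (v ∈? D) ×-dec any? (λ s → (s ∈? S) ×-dec adj? G s v))

    TouchS⁺ : ∀ {s d} → s ∈ S → d ∈ D → Adj G s d → s ∈ TouchS
    TouchS⁺ s∈S d∈D e = ∈-setOf⁺ _ (s∈S , _ , d∈D , e)

    TouchD⁺ : ∀ {s d} → s ∈ S → d ∈ D → Adj G s d → d ∈ TouchD
    TouchD⁺ s∈S d∈D e = ∈-setOf⁺ _ (d∈D , _ , s∈S , e)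

    TouchS⁻ : ∀ {s} → s ∈ TouchS → s ∈ S × ∃ λ d → d ∈ D × Adj G s d
    TouchS⁻ = ∈-setOf⁻ _

    TouchD⁻ : ∀ {d} → d ∈ TouchD → d ∈ D × ∃ λ s → s ∈ S × Adj G s d
    TouchD⁻ = ∈-setOf⁻ _

    -- Two edges between S and D close a cycle through the connected sets
    -- S and D, so their four ends lie in one clique.
    cross-clique : ∀ {x y a b} → x ∈ S → y ∈ S → a ∈ D → b ∈ D → Adj G x a → Adj G y b
                 → ∃ λ K → IsClique G K × x ∈ K × y ∈ K × a ∈ K × b ∈ K
    cross-clique x∈S y∈S a∈D b∈D xa yb =
      square-clique blockGraph (λ s∈ d∈ → D∉S d∈ s∈) (pcS y∈S x∈S) (pcD a∈D b∈D) xa (sym G yb)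

    TouchS-clique : IsClique G TouchS
    TouchS-clique u∈ v∈ u≢v with TouchS⁻ u∈ | TouchS⁻ v∈
    ... | u∈S , _ , a∈D , ua | v∈S , _ , b∈D , vb with cross-clique u∈S v∈S a∈D b∈D ua vb
    ...   | K , clique , u∈K , v∈K , _ = clique u∈K v∈K u≢v

    TouchD-clique : IsClique G TouchD
    TouchD-clique u∈ v∈ u≢v with TouchD⁻ u∈ | TouchD⁻ v∈
    ... | u∈D , _ , x∈S , xu | v∈D , _ , y∈S , yv with cross-clique x∈S y∈S u∈D v∈D xu yv
    ...   | K , clique , _ , _ , u∈K , v∈K = clique u∈K v∈K u≢v

    cross-edge : ∃ λ b → ∃ λ w → b ∈ S × w ∈ D × Adj G b w
    cross-edge with proj₁ cS | proj₁ (proj₁ (proj₂ isCompD))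
    ... | s , s∈S | d , d∈D with leaving-edge (proj₂ conn ∈⊤ ∈⊤) d∈D (λ s∈D → D∉S s∈D s∈S)
    ...   | a , b , a∈D , b∉D , _ , _ , ab with b ∈? S
    ...     | yes b∈S = b , a , b∈S , a∈D , sym G ab
    ...     | no b∉S = contradiction (D-closed a∈D b∉S ab) b∉D

    exchange : ∀ {x w} → x ∈ S → w ∈ D → PairwiseConnectedIn G ((S - x) ∪ ⁅ w ⁆)
      → (∀ {v} → v ∉ (S - x) ∪ ⁅ w ⁆
           → ∃ λ B → v ∈ B × ClosedIn (∁ ((S - x) ∪ ⁅ w ⁆)) B × ∣ B ∣ < ∣ D ∣)
      → Improvement ∣ D ∣
    exchange x∈S w∈D pc cover =
      _ , ((_ , ∈-insertʳ) , pc) , trans (∣swap∣≡ x∈S (D∉S w∈D)) ∣S∣≡k ,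
      components-below (λ v∈ → cover (x∈∁p⇒x∉p v∈))

    -- Case 1: a vertex x ∈ S without neighbours in D is not a cut vertex of
    -- G[S].  Exchange it for a neighbour w ∈ D of S: the complement is
    -- covered by Rest ∪ {x} and D - w.
    exchange-untouching : ∀ {x} → x ∈ S → x ∉ TouchS → PairwiseConnectedIn G (S - x)
                        → Improvement ∣ D ∣
    exchange-untouching {x} x∈S x∉TouchS pcS-x with cross-edge
    ... | b , w , b∈S , w∈D , bw = exchange x∈S w∈D (insert-connected pcS-x b∈S-x bw) cover
      where
      S′ : Subset n
      S′ = (S - x) ∪ ⁅ w ⁆

      x≁D : ∀ {d} → d ∈ D → ¬ Adj G x d
      x≁D d∈D e = x∉TouchS (TouchS⁺ x∈S d∈D e)

      b∈S-x : b ∈ S - x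
      b∈S-x = x∈p∧x≢y⇒x∈p-y b∈S λ { refl → x≁D w∈D bw }

      Rest∪x-closed : ClosedIn (∁ S′) (Rest ∪ ⁅ x ⁆)
      Rest∪x-closed {u} {v} u∈ v∈ e with ∉swap⁻ (x∈∁p⇒x∉p v∈) | v ∈? S | v ∈? D
      ... | _ , in-S⇒x | yes v∈S | _ = subst (_∈ Rest ∪ ⁅ x ⁆) (≡-sym (in-S⇒x v∈S)) ∈-insertʳ
      ... | _ | no v∉S | no v∉D = ∈-insertˡ (Rest⁺ v∉S v∉D)
      ... | _ | no _ | yes v∈D with ∈-insert⁻ u∈
      ...   | inj₁ u∈Rest = contradiction e (Rest≁D u∈Rest v∈D)
      ...   | inj₂ refl = contradiction e (x≁D v∈D)

      D-w-closed : ClosedIn (∁ S′) (D - w)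
      D-w-closed {u} {v} u∈ v∈ e with ∉swap⁻ (x∈∁p⇒x∉p v∈) | x∈p-y⁻ u∈ | v ∈? S
      ... | _ , in-S⇒x | u∈D , _ | yes v∈S =
        contradiction (subst (Adj G u) (in-S⇒x v∈S) e) (λ e′ → x≁D u∈D (sym G e′))
      ... | v≢w , _ | u∈D , _ | no v∉S = x∈p∧x≢y⇒x∈p-y (D-closed u∈D v∉S e) v≢w

      ∣Rest∪x∣<∣D∣ : ∣ Rest ∪ ⁅ x ⁆ ∣ < ∣ D ∣
      ∣Rest∪x∣<∣D∣ = ≤-trans (s≤s (∣p∪⁅x⁆∣≤1+∣p∣ Rest x)) ∣Rest∣+1<∣D∣

      cover : ∀ {v} → v ∉ S′ → ∃ λ B → v ∈ B × ClosedIn (∁ S′) B × ∣ B ∣ < ∣ D ∣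
      cover {v} v∉ with ∉swap⁻ v∉ | v ∈? S | v ∈? D
      ... | _ , in-S⇒x | yes v∈S | _ =
        Rest ∪ ⁅ x ⁆ , subst (_∈ Rest ∪ ⁅ x ⁆) (≡-sym (in-S⇒x v∈S)) ∈-insertʳ , Rest∪x-closed , ∣Rest∪x∣<∣D∣
      ... | _ | no v∉S | no v∉D = Rest ∪ ⁅ x ⁆ , ∈-insertˡ (Rest⁺ v∉S v∉D) , Rest∪x-closed , ∣Rest∪x∣<∣D∣
      ... | v≢w , _ | no _ | yes v∈D = D - w , x∈p∧x≢y⇒x∈p-y v∈D v≢w , D-w-closed , x∈p⇒∣p-x∣<∣p∣ w∈D

    module AllTouching (S⊆TouchS : S ⊆ TouchS) where

      -- Each s ∈ S and q ∈ TouchD lie on a cycle through S and D, hence are adjacent.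
      S~TouchD : ∀ {s q} → s ∈ S → q ∈ TouchD → Adj G s q
      S~TouchD s∈S q∈ with TouchS⁻ (S⊆TouchS s∈S) | TouchD⁻ q∈
      ... | _ , d , d∈D , sd | q∈D , s′ , s′∈S , s′q with cross-clique s∈S s′∈S d∈D q∈D sd s′q
      ...   | K , clique , s∈K , _ , _ , q∈K = clique s∈K q∈K λ { refl → D∉S q∈D s∈S }

      -- S ∪ TouchD is a clique, so ∣TouchD∣ ≤ ω - k ≤ k < ∣D∣.
      S∪TouchD-clique : IsClique G (S ∪ TouchD)
      S∪TouchD-clique {u} {v} u∈ v∈ u≢v with x∈p∪q⁻ S TouchD u∈ | x∈p∪q⁻ S TouchD v∈
      ... | inj₁ u∈S | inj₁ v∈S = TouchS-clique (S⊆TouchS u∈S) (S⊆TouchS v∈S) u≢v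
      ... | inj₁ u∈S | inj₂ v∈T = S~TouchD u∈S v∈T
      ... | inj₂ u∈T | inj₁ v∈S = sym G (S~TouchD v∈S u∈T)
      ... | inj₂ u∈T | inj₂ v∈T = TouchD-clique u∈T v∈T u≢v

      ∣TouchD∣≤k : ∣ TouchD ∣ ≤ k
      ∣TouchD∣≤k = +-cancelˡ-≤ k ∣ TouchD ∣ k (begin
        k + ∣ TouchD ∣       ≡⟨ cong (_+ ∣ TouchD ∣) (≡-sym ∣S∣≡k) ⟩
        ∣ S ∣ + ∣ TouchD ∣   ≤⟨ ∣disjoint∣≤ S TouchD (λ s∈ q∈ → D∉S (proj₁ (TouchD⁻ q∈)) s∈)
                                   (p⊆p∪q TouchD) (q⊆p∪q S TouchD) ⟩
        ∣ S ∪ TouchD ∣       ≤⟨ ω-max (S ∪ TouchD) S∪TouchD-clique ⟩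
        ω                    ≤⟨ ω≤2k ⟩
        k + k                ∎)
        where open ≤-Reasoning

      boundary-edge : ∃ λ d′ → ∃ λ w → d′ ∈ D × d′ ∉ TouchD × w ∈ D × w ∈ TouchD × Adj G d′ w
      boundary-edge with any? (λ v → (v ∈? D) ×-dec ¬? (v ∈? TouchD))
      ... | no ¬untouched =
        contradiction (≤-trans k<∣D∣ (≤-trans (p⊆q⇒∣p∣≤∣q∣ D⊆TouchD) ∣TouchD∣≤k)) (n≮n k)
        where
        D⊆TouchD : D ⊆ TouchD
        D⊆TouchD {v} v∈D = decidable-stable (v ∈? TouchD) λ v∉ → ¬untouched (v , v∈D , v∉)
      ... | yes (d , d∈D , d∉T) with cross-edge
      ...   | b , w₀ , b∈S , w₀∈D , bw₀
              with leaving-edge {T = ∁ TouchD} (pcD d∈D w₀∈D) (x∉p⇒x∈∁p d∉T) (x∈p⇒x∉∁p (TouchD⁺ b∈S w₀∈D bw₀))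
      ...     | d′ , w , d′∈ , w∉ , d′∈D , w∈D , d′w =
        d′ , w , d′∈D , x∈∁p⇒x∉p d′∈ , w∈D , x∉∁p⇒x∈p w∉ , d′w

      module _ {d′ w} (d′∈D : d′ ∈ D) (d′∉TouchD : d′ ∉ TouchD) (w∈D : w ∈ D)
               (w∈TouchD : w ∈ TouchD) (d′w : Adj G d′ w) where

        Near : Subset n
        Near = reach (D - w) (TouchD - w)

        -- d′ is not near: a walk q ⇝ d′ in D - w with q ∈ TouchD closes, for
        -- any s ∈ S, the cycle s w d′ ⇝ q s, so d′ would be adjacent to s.
        d′∉Near : d′ ∉ Near
        d′∉Near d′∈ = d′∉TouchD (closes-cycle (reach-sound (D - w) d′∈) (proj₁ cS))
          where
          closes-cycle : ReachableFrom (D - w) (TouchD - w) d′ → Nonempty S → d′ ∈ TouchD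
          closes-cycle (q , q∈ , q⇝d′) (s , s∈S) = TouchD⁺ s∈S d′∈D (s~d′ clique-through-s)
            where
            disjoint : Disjoint (⁅ s ⁆ ∪ ⁅ w ⁆) (D - w)
            disjoint t∈ t∈D-w with ∈-pair⁻ t∈
            ... | inj₁ refl = D∉S (proj₁ (x∈p-y⁻ t∈D-w)) s∈S
            ... | inj₂ refl = x∉p-x D w t∈D-w
            clique-through-s : ∃ λ K → IsClique G K × w ∈ K × s ∈ K × d′ ∈ K × q ∈ K
            clique-through-s = square-clique blockGraph disjoint
              (edge-walk (S~TouchD s∈S w∈TouchD)) (walk-reverse q⇝d′)
              (sym G d′w) (sym G (S~TouchD s∈S (proj₁ (x∈p-y⁻ q∈))))
            s~d′ : (∃ λ K → IsClique G K × w ∈ K × s ∈ K × d′ ∈ K × q ∈ K) → Adj G s d′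
            s~d′ (K , clique , _ , s∈K , d′∈K , _) = clique s∈K d′∈K λ { refl → D∉S d′∈D s∈S }

        -- Distinct vertices a, a′ of S have no common neighbour r ∈ Rest:
        -- the cycle a′ r a w would have the chord rw, putting r into D.
        rest-neighbour-unique : ∀ {a a′ r} → a ∈ S → a′ ∈ S → r ∈ Rest → Adj G a r → Adj G a′ r → a ≡ a′
        rest-neighbour-unique {a} {a′} {r} a∈S a′∈S r∈ ar a′r = decidable-stable (a ≟ a′) λ a≢a′ →
          Rest≁D r∈ w∈D (r~w (square-clique blockGraph (disjoint a≢a′) (edge-walk a′r)
            (edge-walk (S~TouchD a∈S w∈TouchD)) (sym G ar) (sym G (S~TouchD a′∈S w∈TouchD))))
          where
          disjoint : a ≢ a′ → Disjoint (⁅ a′ ⁆ ∪ ⁅ r ⁆) (⁅ a ⁆ ∪ ⁅ w ⁆)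
          disjoint a≢a′ t∈ t∈′ with ∈-pair⁻ t∈ | ∈-pair⁻ t∈′
          ... | inj₁ refl | inj₁ refl = a≢a′ refl
          ... | inj₁ refl | inj₂ refl = D∉S w∈D a′∈S
          ... | inj₂ refl | inj₁ refl = proj₁ (Rest⁻ r∈) a∈S
          ... | inj₂ refl | inj₂ refl = proj₂ (Rest⁻ r∈) w∈D
          r~w : (∃ λ K → IsClique G K × r ∈ K × a′ ∈ K × a ∈ K × w ∈ K) → Adj G r w
          r~w (K , clique , r∈K , _ , _ , w∈K) = clique r∈K w∈K λ { refl → proj₂ (Rest⁻ r∈) w∈D }

        -- Some x ∈ S has no neighbour in Rest; otherwise the neighbours in
        -- Rest would give ∣S∣ ≤ ∣Rest∣ < k.
        quiet-vertex : ∃ λ x → x ∈ S × (∀ {r} → r ∈ Rest → ¬ Adj G x r)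
        quiet-vertex with any? (λ x → (x ∈? S) ×-dec all? (λ r → (r ∈? Rest) →-dec ¬? (adj? G x r)))
        ... | yes (x , x∈S , quiet) = x , x∈S , λ {r} → quiet r
        ... | no ¬quiet =
          contradiction (≤-trans ∣Rest∣<k (≤-trans (≤-reflexive (≡-sym ∣S∣≡k)) ∣S∣≤∣Rest∣)) (n≮n _)
          where
          has-neighbour : ∀ {a} → a ∈ S → ∃ λ r → r ∈ Rest × Adj G a r
          has-neighbour {a} a∈S = decidable-stable (any? (λ r → (r ∈? Rest) ×-dec adj? G a r))
            λ none → ¬quiet (a , a∈S , λ r r∈ e → none (r , r∈ , e))
          ∣S∣≤∣Rest∣ : ∣ S ∣ ≤ ∣ Rest ∣
          ∣S∣≤∣Rest∣ = ∣A∣≤∣B∣-by-partners (Adj G) has-neighbour rest-neighbour-unique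

        -- Exchange a quiet vertex x for w.  The new set is a clique, and the
        -- complement is covered by Near ∪ {x}, Far = (D - w) minus Near, and
        -- Rest, all closed and smaller than D (Near misses d′ ∈ D - w).
        module _ {x} (x∈S : x ∈ S) (x≁Rest : ∀ {r} → r ∈ Rest → ¬ Adj G x r) where

          S′ : Subset n
          S′ = (S - x) ∪ ⁅ w ⁆

          -- S - x ⊆ S is a clique and w is adjacent to all of S.
          S′-clique : IsClique G S′
          S′-clique {u} {v} u∈ v∈ u≢v with ∈-insert⁻ u∈ | ∈-insert⁻ v∈
          ... | inj₁ u∈S-x | inj₁ v∈S-x = S∪TouchD-clique (p⊆p∪q TouchD (proj₁ (x∈p-y⁻ u∈S-x)))
                                                          (p⊆p∪q TouchD (proj₁ (x∈p-y⁻ v∈S-x))) u≢v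
          ... | inj₁ u∈S-x | inj₂ refl = S~TouchD (proj₁ (x∈p-y⁻ u∈S-x)) w∈TouchD
          ... | inj₂ refl | inj₁ v∈S-x = sym G (S~TouchD (proj₁ (x∈p-y⁻ v∈S-x)) w∈TouchD)
          ... | inj₂ refl | inj₂ refl = contradiction refl u≢v

          Far : Subset n
          Far = setOf (λ v → (v ∈? D - w) ×-dec ¬? (v ∈? Near))

          touching-is-near : ∀ {s v} → s ∈ S → v ∈ D → v ≢ w → Adj G s v → v ∈ Near
          touching-is-near s∈S v∈D v≢w e =
            reach-complete (D - w) (x∈p∧x≢y⇒x∈p-y (TouchD⁺ s∈S v∈D e) v≢w) (here (x∈p∧x≢y⇒x∈p-y v∈D v≢w))

          Near∪x-closed : ClosedIn (∁ S′) (Near ∪ ⁅ x ⁆)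
          Near∪x-closed {u} {v} u∈ v∈ e with ∉swap⁻ (x∈∁p⇒x∉p v∈) | v ∈? S
          ... | _ , in-S⇒x | yes v∈S = subst (_∈ Near ∪ ⁅ x ⁆) (≡-sym (in-S⇒x v∈S)) ∈-insertʳ
          ... | v≢w , _ | no v∉S with ∈-insert⁻ u∈
          ...   | inj₁ u∈Near = ∈-insertˡ (reach-closed (D - w) (TouchD - w) u∈Near v∈D-w e)
            where
            v∈D-w : v ∈ D - w
            v∈D-w = x∈p∧x≢y⇒x∈p-y (D-closed (proj₁ (x∈p-y⁻ (reach⊆X (D - w) _ u∈Near))) v∉S e) v≢w
          ...   | inj₂ refl with v ∈? D
          ...     | yes v∈D = ∈-insertˡ (touching-is-near x∈S v∈D v≢w e)
          ...     | no v∉D = contradiction e (x≁Rest (Rest⁺ v∉S v∉D))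

          Far-closed : ClosedIn (∁ S′) Far
          Far-closed {u} {v} u∈ v∈ e with ∉swap⁻ (x∈∁p⇒x∉p v∈) | ∈-setOf⁻ _ u∈
          ... | v≢w , in-S⇒x | u∈D-w , u∉Near with x∈p-y⁻ u∈D-w | v ∈? S
          ...   | u∈D , u≢w | yes v∈S =
            contradiction (touching-is-near x∈S u∈D u≢w (sym G (subst (Adj G u) (in-S⇒x v∈S) e))) u∉Near
          ...   | u∈D , _ | no v∉S with v ∈? Near
          ...     | yes v∈Near = contradiction (reach-closed (D - w) (TouchD - w) v∈Near u∈D-w (sym G e)) u∉Near
          ...     | no v∉Near = ∈-setOf⁺ _ (x∈p∧x≢y⇒x∈p-y (D-closed u∈D v∉S e) v≢w , v∉Near)

          Rest-closed : ClosedIn (∁ S′) Rest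
          Rest-closed {u} {v} u∈ v∈ e with ∉swap⁻ (x∈∁p⇒x∉p v∈) | v ∈? S | v ∈? D
          ... | _ , in-S⇒x | yes v∈S | _ = contradiction (sym G (subst (Adj G u) (in-S⇒x v∈S) e)) (x≁Rest u∈)
          ... | _ | no _ | yes v∈D = contradiction e (Rest≁D u∈ v∈D)
          ... | _ | no v∉S | no v∉D = Rest⁺ v∉S v∉D

          ∣D-w∣<∣D∣ : ∣ D - w ∣ < ∣ D ∣
          ∣D-w∣<∣D∣ = x∈p⇒∣p-x∣<∣p∣ w∈D

          ∣Near∪x∣<∣D∣ : ∣ Near ∪ ⁅ x ⁆ ∣ < ∣ D ∣
          ∣Near∪x∣<∣D∣ = ≤-trans (s≤s (≤-trans (∣p∪⁅x⁆∣≤1+∣p∣ Near x) Near⊂D-w)) ∣D-w∣<∣D∣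
            where
            Near⊂D-w : ∣ Near ∣ < ∣ D - w ∣
            Near⊂D-w = p⊂q⇒∣p∣<∣q∣
              (reach⊆X (D - w) _ , d′ , x∈p∧x≢y⇒x∈p-y d′∈D (λ { refl → d′∉TouchD w∈TouchD }) , d′∉Near)

          ∣Far∣<∣D∣ : ∣ Far ∣ < ∣ D ∣
          ∣Far∣<∣D∣ = ≤-trans (s≤s (p⊆q⇒∣p∣≤∣q∣ {p = Far} {q = D - w} λ v∈ → proj₁ (∈-setOf⁻ _ v∈))) ∣D-w∣<∣D∣

          cover : ∀ {v} → v ∉ S′ → ∃ λ B → v ∈ B × ClosedIn (∁ S′) B × ∣ B ∣ < ∣ D ∣
          cover {v} v∉ with ∉swap⁻ v∉ | v ∈? S | v ∈? D
          ... | _ , in-S⇒x | yes v∈S | _ =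
            Near ∪ ⁅ x ⁆ , subst (_∈ Near ∪ ⁅ x ⁆) (≡-sym (in-S⇒x v∈S)) ∈-insertʳ , Near∪x-closed , ∣Near∪x∣<∣D∣
          ... | _ | no v∉S | no v∉D = Rest , Rest⁺ v∉S v∉D , Rest-closed , ≤-trans (n≤1+n _) ∣Rest∣+1<∣D∣
          ... | v≢w , _ | no _ | yes v∈D with v ∈? Near
          ...   | yes v∈Near = Near ∪ ⁅ x ⁆ , ∈-insertˡ v∈Near , Near∪x-closed , ∣Near∪x∣<∣D∣
          ...   | no v∉Near = Far , ∈-setOf⁺ _ (x∈p∧x≢y⇒x∈p-y v∈D v≢w , v∉Near) , Far-closed , ∣Far∣<∣D∣

          exchange-quiet : Improvement ∣ D ∣
          exchange-quiet = exchange x∈S w∈D (clique-connected S′-clique ∈-insertʳ) cover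

        exchange-quiet-vertex : Improvement ∣ D ∣
        exchange-quiet-vertex with quiet-vertex
        ... | _ , x∈S , x≁Rest = exchange-quiet x∈S x≁Rest

      exchange-all-touching : Improvement ∣ D ∣
      exchange-all-touching with boundary-edge
      ... | _ , _ , d′∈D , d′∉TouchD , w∈D , w∈TouchD , d′w =
        exchange-quiet-vertex d′∈D d′∉TouchD w∈D w∈TouchD d′w

    -- Either some vertex of S has no neighbour in D, and then (as TouchS is
    -- a nonempty connected proper part of S) one such vertex is not a cut
    -- vertex of G[S]; or every vertex of S touches D.
    improve : Improvement ∣ D ∣
    improve with any? (λ y → (y ∈? S) ×-dec ¬? (y ∈? TouchS))
    ... | no ¬untouched = AllTouching.exchange-all-touching
                            λ {y} y∈S → decidable-stable (y ∈? TouchS) λ y∉ → ¬untouched (y , y∈S , y∉)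
    ... | yes (y , y∈S , y∉TouchS) with cross-edge
    ...   | b , w , b∈S , w∈D , bw
              with non-cut-vertex-outside (λ t∈ → proj₁ (TouchS⁻ t∈)) pcS
                     (clique-connected TouchS-clique (TouchS⁺ b∈S w∈D bw)) (TouchS⁺ b∈S w∈D bw) y∈S y∉TouchS
    ...     | x , x∈S , x∉TouchS , pcS-x = exchange-untouching x∈S x∉TouchS pcS-x

  connected-safe-set : ∀ m {S} → ConnectedSet G S → ∣ S ∣ ≡ k
    → (∀ D → IsComponentOf G (∁ S) D → ∣ D ∣ ≤ m) → ConnectedSafeNumber≤ G k
  connected-safe-set m {S} cS ∣S∣≡k ≤m with large-component? S k
  ... | inj₁ small =
    S , (cS , safe-if-components-small cS λ D isComp → subst (∣ D ∣ ≤_) (≡-sym ∣S∣≡k) (small D isComp)) ,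
    ≤-reflexive ∣S∣≡k
  ... | inj₂ (D , isCompD , k<∣D∣) with m | ≤m D isCompD | improve cS ∣S∣≡k isCompD k<∣D∣
  ...   | zero | ∣D∣≤0 | _ = contradiction (≤-trans k<∣D∣ ∣D∣≤0) λ ()
  ...   | suc m′ | ∣D∣≤1+m′ | S′ , cS′ , ∣S′∣≡k , smaller =
    connected-safe-set m′ cS′ ∣S′∣≡k λ D′ isComp → ≤-pred (≤-trans (smaller D′ isComp) ∣D∣≤1+m′)

m≤⌈m/[1+d]⌉*[1+d] : ∀ m d → m ≤ ((m + d) / suc d) * suc d
m≤⌈m/[1+d]⌉*[1+d] m d = +-cancelʳ-≤ d m _ (begin
  m + d                                         ≡⟨ m≡m%n+[m/n]*n (m + d) (suc d) ⟩
  (m + d) % suc d + ((m + d) / suc d) * suc d   ≤⟨ +-monoˡ-≤ _ (≤-pred (m%n<n (m + d) (suc d))) ⟩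
  d + ((m + d) / suc d) * suc d                 ≡⟨ +-comm d _ ⟩
  ((m + d) / suc d) * suc d + d                 ∎)
  where open ≤-Reasoning

⌈m/[1+d]⌉≤ : ∀ m d N → m + d ≤ N * suc d → (m + d) / suc d ≤ N
⌈m/[1+d]⌉≤ m d N m+d≤ = ≤-trans (/-monoˡ-≤ (suc d) m+d≤) (≤-reflexive (m*n/n≡m N (suc d)))

q*2≡q+q : ∀ q → q * 2 ≡ q + q
q*2≡q+q = solve 1 (λ q → q :* con 2 := q :+ q) refl
  where open +-*-Solver

q*3≡q+q+q : ∀ q → q * 3 ≡ q + q + q
q*3≡q+q+q = solve 1 (λ q → q :* con 3 := q :+ q :+ q) refl
  where open +-*-Solver

size-bounds : ∀ n ω → 1 ≤ n → ω ≤ n → let k = ⌈ n /3⌉ ⊔ ⌈ ω /2⌉′ in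
              1 ≤ k × k ≤ n × n ≤ k + k + k × ω ≤ k + k
size-bounds n ω 1≤n ω≤n = 1≤k , k≤n , n≤3k , ω≤2k
  where
  open ≤-Reasoning
  k : ℕ
  k = ⌈ n /3⌉ ⊔ ⌈ ω /2⌉′
  n≤3k : n ≤ k + k + k
  n≤3k = begin
    n                  ≤⟨ m≤⌈m/[1+d]⌉*[1+d] n 2 ⟩
    ⌈ n /3⌉ * 3        ≤⟨ *-monoˡ-≤ 3 (m≤m⊔n ⌈ n /3⌉ ⌈ ω /2⌉′) ⟩
    k * 3              ≡⟨ q*3≡q+q+q k ⟩
    k + k + k          ∎
  ω≤2k : ω ≤ k + k
  ω≤2k = begin
    ω                  ≤⟨ m≤⌈m/[1+d]⌉*[1+d] ω 1 ⟩
    ⌈ ω /2⌉′ * 2       ≤⟨ *-monoˡ-≤ 2 (m≤n⊔m ⌈ n /3⌉ ⌈ ω /2⌉′) ⟩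
    k * 2              ≡⟨ q*2≡q+q k ⟩
    k + k              ∎
  k≤n : k ≤ n
  k≤n = ⊔-lub (⌈m/[1+d]⌉≤ n 2 n (begin
                 n + 2              ≤⟨ +-monoʳ-≤ n (+-mono-≤ 1≤n 1≤n) ⟩
                 n + (n + n)        ≡⟨ +-assoc n n n ⟨
                 n + n + n          ≡⟨ q*3≡q+q+q n ⟨
                 n * 3              ∎))
              (⌈m/[1+d]⌉≤ ω 1 n (begin
                 ω + 1              ≤⟨ +-mono-≤ ω≤n 1≤n ⟩
                 n + n              ≡⟨ q*2≡q+q n ⟨
                 n * 2              ∎))
  1≤k : 1 ≤ k
  1≤k = ≤-trans (positive ⌈ n /3⌉ (m≤⌈m/[1+d]⌉*[1+d] n 2)) (m≤m⊔n ⌈ n /3⌉ ⌈ ω /2⌉′)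
    where
    positive : ∀ q → n ≤ q * 3 → 1 ≤ q
    positive zero n≤0 = ≤-trans 1≤n n≤0
    positive (suc q) _ = s≤s z≤n

theorem6 : ∀ (n : ℕ) (G : Graph n) (ω : ℕ) → Connected G → IsBlockGraph G
    → CliqueNumber G ω → ConnectedSafeNumber≤ G (⌈ n /3⌉ ⊔ ⌈ ω /2⌉′)
theorem6 zero G ω ((() , _) , _) _ _
theorem6 n@(suc _) G ω conn blockGraph ((K , _ , ∣K∣≡ω) , ω-max)
  with size-bounds n ω (s≤s z≤n) (≤-trans (≤-reflexive (≡-sym ∣K∣≡ω)) (∣p∣≤n K))
... | 1≤k , k≤n , n≤3k , ω≤2k with Components.connected-subset G conn _ 1≤k k≤n
...   | S , cS , ∣S∣≡k =
  Exchange.connected-safe-set G conn blockGraph ω-max n≤3k ω≤2k n cS ∣S∣≡k (λ D _ → ∣p∣≤n D)
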